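{- Let $\mathcal{B}$ be a topos and let $\mathsf{Adj}(\mathcal{B})_{=}$ be the category of partial orders internal to $\mathcal{B}$ and order adjunctions. Then the class $\mathsf{Ref}(\mathcal{B})$ of reflections and the class $\mathsf{Ref}(\mathcal{B})^{\propto}$ of coreflections form a factorization system $\langle\mathsf{Ref}(\mathcal{B}),\mathsf{Ref}(\mathcal{B})^{\propto}\rangle$ on $\mathsf{Adj}(\mathcal{B})_{=}$; moreover the polar factorization (each adjunction $\mathbf g$ factored as its extent reflection $\mathbf A_0\rightleftharpoons\diamondsuit(\mathbf g)$ followed by its intent coreflection $\diamondsuit(\mathbf g)\rightleftharpoons\mathbf A_1$ through the axis $\diamondsuit(\mathbf g)$) makes it a factorization system with choice.
   Context: Internal preorders/partial orders in a topos $\mathcal{B}$, monotonic morphisms and their pointwise internal order are as usual. An order adjunction $\mathbf{g}=\langle\check{\mathbf g},\hat{\mathbf g}\rangle:\mathbf{A}_0\rightleftharpoons\mathbf{A}_1$ consists of monotonic $\check{\mathbf g}:\mathbf A_0\to\mathbf A_1$, $\hat{\mathbf g}:\mathbf A_1\to\mathbf A_0$ with $1\le\hat{\mathbf g}\circ\check{\mathbf g}$ and $\check{\mathbf g}\circ\hat{\mathbf g}\le 1$; adjunctions compose componentwise ($\mathbf g$ followed by $\mathbf h$ is $\langle\check{\mathbf h}\circ\check{\mathbf g},\hat{\mathbf g}\circ\hat{\mathbf h}\rangle$). A reflection is an adjunction with $\check{\mathbf g}\circ\hat{\mathbf g}=1_{A_1}$; a coreflection one with $\hat{\mathbf g}\circ\check{\mathbf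 g}=1_{A_0}$. For an adjunction $\mathbf g$, let $\mathsf{clo}(\mathbf g)\hookrightarrow\mathbf A_0$ be the equalizer of $1$ and $\hat{\mathbf g}\circ\check{\mathbf g}$ and $\mathsf{open}(\mathbf g)\hookrightarrow\mathbf A_1$ the equalizer of $1$ and $\check{\mathbf g}\circ\hat{\mathbf g}$; the axis $\diamondsuit(\mathbf g)$ is the pullback in internal preorders of the two opspans formed by the inclusion $\mathsf{clo}(\mathbf g)\to\mathbf A_0$ with the restricted right adjoint $\mathsf{open}(\mathbf g)\to\mathbf A_0$, and the restricted left adjoint $\mathsf{clo}(\mathbf g)\to\mathbf A_1$ with the inclusion $\mathsf{open}(\mathbf g)\to\mathbf A_1$ (internally: pairs $(a,b)$ of a closed $a$ and open $b$ with $a=\hat{\mathbf g}(b)$, $b=\check{\mathbf g}(a)$). A factorization system $\langle\mathcal E,\mathcal M\rangle$ on a category means: all isomorphisms lie in $\mathcal E\cap\mathcal M$ and both classes are closed under composition; every morphism factors as a morphism in $\mathcal E$ followed by one in $\mathcal M$; and for every commutative square ($e$ then $s$ equals $r$ then $m$) with $e\in\mathcal E$, $m\in\mathcal M$ there is a unique diagonal $d$ with $e$ then $d$ equal to $r$ and $d$ then $m$ equal to $s$. "With choice" means a specified factorization is chosen for every morphism. -}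

module Defs where

open import Level using (Level; _⊔_) renaming (suc to lsuc)
open import Data.Product using (Σ; _×_; _,_; proj₁; proj₂)
open import Relation.Binary using (Rel; IsEquivalence)

record Category (o ℓ e : Level) : Set (lsuc (o ⊔ ℓ ⊔ e)) where
  infixr 9 _∘_
  infix  4 _≈_
  infix  5 _⇒_
  field
    Obj       : Set o
    _⇒_       : Obj → Obj → Set ℓ
    _≈_       : ∀ {A B} → Rel (A ⇒ B) e
    id        : ∀ {A} → A ⇒ A
    _∘_       : ∀ {A B C} → B ⇒ C → A ⇒ B → A ⇒ C
    equiv     : ∀ {A B} → IsEquivalence (_≈_ {A} {B})
    assoc     : ∀ {A B C D} {f : A ⇒ B} {g : B ⇒ C} {h : C ⇒ D} →
                (h ∘ g) ∘ f ≈ h ∘ (g ∘ f)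
    identityˡ : ∀ {A B} {f : A ⇒ B} → id ∘ f ≈ f
    identityʳ : ∀ {A B} {f : A ⇒ B} → f ∘ id ≈ f
    ∘-resp-≈  : ∀ {A B C} {f h : B ⇒ C} {g i : A ⇒ B} →
                f ≈ h → g ≈ i → f ∘ g ≈ h ∘ i

module Limits {o ℓ e : Level} (𝒞 : Category o ℓ e) where
  open Category 𝒞

  Mono : ∀ {A B} → A ⇒ B → Set (o ⊔ ℓ ⊔ e)
  Mono {A} m = ∀ {X} (f g : X ⇒ A) → m ∘ f ≈ m ∘ g → f ≈ g

  record Terminal : Set (o ⊔ ℓ ⊔ e) where
    field
      ⊤       : Obj
      !       : ∀ {A} → A ⇒ ⊤
      !-unique : ∀ {A} (f : A ⇒ ⊤) → f ≈ !

  record Product (A B : Obj) : Set (o ⊔ ℓ ⊔ e) where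
    field
      A×B     : Obj
      π₁      : A×B ⇒ A
      π₂      : A×B ⇒ B
      ⟨_,_⟩   : ∀ {X} → X ⇒ A → X ⇒ B → X ⇒ A×B
      project₁ : ∀ {X} {f : X ⇒ A} {g : X ⇒ B} → π₁ ∘ ⟨ f , g ⟩ ≈ f
      project₂ : ∀ {X} {f : X ⇒ A} {g : X ⇒ B} → π₂ ∘ ⟨ f , g ⟩ ≈ g
      unique   : ∀ {X} {f : X ⇒ A} {g : X ⇒ B} (h : X ⇒ A×B) →
                 π₁ ∘ h ≈ f → π₂ ∘ h ≈ g → h ≈ ⟨ f , g ⟩

  record Equalizer {A B : Obj} (f g : A ⇒ B) : Set (o ⊔ ℓ ⊔ e) where
    field
      E        : Obj
      arr      : E ⇒ A
      equality : f ∘ arr ≈ g ∘ arr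
      equalize : ∀ {X} (h : X ⇒ A) → f ∘ h ≈ g ∘ h → X ⇒ E
      universal : ∀ {X} (h : X ⇒ A) (eq : f ∘ h ≈ g ∘ h) → arr ∘ equalize h eq ≈ h
      unique   : ∀ {X} (h : X ⇒ A) (eq : f ∘ h ≈ g ∘ h) (i : X ⇒ E) →
                 arr ∘ i ≈ h → i ≈ equalize h eq

  record IsPullback {A B C P : Obj} (f : A ⇒ C) (g : B ⇒ C)
                    (p₁ : P ⇒ A) (p₂ : P ⇒ B) : Set (o ⊔ ℓ ⊔ e) where
    field
      commute   : f ∘ p₁ ≈ g ∘ p₂
      universal : ∀ {X} (h₁ : X ⇒ A) (h₂ : X ⇒ B) → f ∘ h₁ ≈ g ∘ h₂ →
                  Σ (X ⇒ P) λ u → (p₁ ∘ u ≈ h₁) × (p₂ ∘ u ≈ h₂) ×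
                    (∀ (u' : X ⇒ P) → p₁ ∘ u' ≈ h₁ → p₂ ∘ u' ≈ h₂ → u' ≈ u)

  record Pullback {A B C : Obj} (f : A ⇒ C) (g : B ⇒ C) : Set (o ⊔ ℓ ⊔ e) where
    field
      P          : Obj
      p₁         : P ⇒ A
      p₂         : P ⇒ B
      isPullback : IsPullback f g p₁ p₂

record Topos (o ℓ e : Level) : Set (lsuc (o ⊔ ℓ ⊔ e)) where
  field
    cat : Category o ℓ e
  open Category cat
  open Limits cat
  field
    terminal  : Terminal
    product   : ∀ (A B : Obj) → Product A B
    equalizer : ∀ {A B} (f g : A ⇒ B) → Equalizer f g
    pullback  : ∀ {A B C} (f : A ⇒ C) (g : B ⇒ C) → Pullback f g
  open Terminal terminal
  infixr 7 _⊗_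
  infixr 7 _⊗₁_
  infixr 8 _^_
  _⊗_ : Obj → Obj → Obj
  A ⊗ B = Product.A×B (product A B)
  _⊗₁_ : ∀ {A B C D} → A ⇒ C → B ⇒ D → A ⊗ B ⇒ C ⊗ D
  _⊗₁_ {A} {B} {C} {D} f g =
    Product.⟨_,_⟩ (product C D) (f ∘ Product.π₁ (product A B)) (g ∘ Product.π₂ (product A B))
  field
    _^_    : Obj → Obj → Obj
    eval   : ∀ {A B} → (B ^ A) ⊗ A ⇒ B
    curry  : ∀ {X A B} → X ⊗ A ⇒ B → X ⇒ B ^ A
    β      : ∀ {X A B} (f : X ⊗ A ⇒ B) → eval ∘ (curry f ⊗₁ id) ≈ f
    curry-unique : ∀ {X A B} (f : X ⊗ A ⇒ B) (h : X ⇒ B ^ A) →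
                   eval ∘ (h ⊗₁ id) ≈ f → h ≈ curry f
    Ω      : Obj
    true   : ⊤ ⇒ Ω
    χ      : ∀ {U X} (m : U ⇒ X) → Mono m → X ⇒ Ω
    χ-pullback : ∀ {U X} (m : U ⇒ X) (mono : Mono m) → IsPullback (χ m mono) true m !
    χ-unique   : ∀ {U X} (m : U ⇒ X) (mono : Mono m) (c : X ⇒ Ω) →
                 IsPullback c true m ! → c ≈ χ m mono

module Internal {o ℓ e : Level} (T : Topos o ℓ e) where
  open Topos T
  open Category cat
  open Limits cat

  record IRel : Set (o ⊔ ℓ) where
    field
      Car : Obj
      Rl  : Obj
      rel : Rl ⇒ Car ⊗ Car
  open IRel public

  pair : ∀ {X A B} → X ⇒ A → X ⇒ B → X ⇒ A ⊗ B
  pair {A = A} {B} = Product.⟨_,_⟩ (product A B)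

  -- generalized elements a, b : X → A satisfy  a ≤ b  iff ⟨a,b⟩ factors through the relation
  _∋_≤_ : (P : IRel) {X : Obj} → X ⇒ Car P → X ⇒ Car P → Set (ℓ ⊔ e)
  P ∋ a ≤ b = Σ (_ ⇒ Rl P) λ h → rel P ∘ h ≈ pair a b

  record IsPartialOrder (P : IRel) : Set (o ⊔ ℓ ⊔ e) where
    field
      rel-mono : Mono (rel P)
      refl     : ∀ {X} (a : X ⇒ Car P) → P ∋ a ≤ a
      trans    : ∀ {X} {a b c : X ⇒ Car P} → P ∋ a ≤ b → P ∋ b ≤ c → P ∋ a ≤ c
      antisym  : ∀ {X} {a b : X ⇒ Car P} → P ∋ a ≤ b → P ∋ b ≤ a → a ≈ b

  -- objects of Adj(B)_= : internal partial orders
  IPoset : Set (o ⊔ ℓ ⊔ e)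
  IPoset = Σ IRel IsPartialOrder

  ∣_∣ : IPoset → IRel
  ∣ P ∣ = proj₁ P

  Monotone : (P Q : IRel) → Car P ⇒ Car Q → Set (o ⊔ ℓ ⊔ e)
  Monotone P Q f = ∀ {X} {a b : X ⇒ Car P} → P ∋ a ≤ b → Q ∋ (f ∘ a) ≤ (f ∘ b)

  _⊢_≤_ : (Q : IRel) {A : Obj} → A ⇒ Car Q → A ⇒ Car Q → Set (ℓ ⊔ e)
  Q ⊢ f ≤ g = Q ∋ f ≤ g

  record Pair (P Q : IRel) : Set ℓ where
    constructor ⟪_,_⟫
    field
      lft : Car P ⇒ Car Q
      rgt : Car Q ⇒ Car P
  open Pair public

  _⨾_ : ∀ {P Q S} → Pair P Q → Pair Q S → Pair P S
  g ⨾ h = ⟪ lft h ∘ lft g , rgt g ∘ rgt h ⟫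

  idPair : ∀ {P} → Pair P P
  idPair = ⟪ id , id ⟫

  _≋_ : ∀ {P Q} → Pair P Q → Pair P Q → Set e
  g ≋ h = (lft g ≈ lft h) × (rgt g ≈ rgt h)

  record IsAdjunction {P Q : IRel} (g : Pair P Q) : Set (o ⊔ ℓ ⊔ e) where
    field
      lft-mono : Monotone P Q (lft g)
      rgt-mono : Monotone Q P (rgt g)
      unit     : P ⊢ id ≤ (rgt g ∘ lft g)
      counit   : Q ⊢ (lft g ∘ rgt g) ≤ id

  Reflection : ∀ {P Q} → Pair P Q → Set (o ⊔ ℓ ⊔ e)
  Reflection g = IsAdjunction g × (lft g ∘ rgt g ≈ id)

  Coreflection : ∀ {P Q} → Pair P Q → Set (o ⊔ ℓ ⊔ e)
  Coreflection g = IsAdjunction g × (rgt g ∘ lft g ≈ id)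

  IsIso : ∀ {P Q} → Pair P Q → Set (o ⊔ ℓ ⊔ e)
  IsIso {P} {Q} g = IsAdjunction g × Σ (Pair Q P) λ h →
                    IsAdjunction h × ((g ⨾ h) ≋ idPair) × ((h ⨾ g) ≋ idPair)

  Class : Set (lsuc (o ⊔ ℓ ⊔ e))
  Class = ∀ {P Q : IRel} → Pair P Q → Set (o ⊔ ℓ ⊔ e)

  record IsFactorizationSystem (𝓔 𝓜 : Class) : Set (lsuc (o ⊔ ℓ ⊔ e)) where
    field
      iso⊆𝓔   : ∀ (A B : IPoset) (g : Pair ∣ A ∣ ∣ B ∣) → IsIso g → 𝓔 g
      iso⊆𝓜   : ∀ (A B : IPoset) (g : Pair ∣ A ∣ ∣ B ∣) → IsIso g → 𝓜 g
      𝓔-comp  : ∀ (A B C : IPoset) (g : Pair ∣ A ∣ ∣ B ∣) (h : Pair ∣ B ∣ ∣ C ∣) →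
                𝓔 g → 𝓔 h → 𝓔 (g ⨾ h)
      𝓜-comp  : ∀ (A B C : IPoset) (g : Pair ∣ A ∣ ∣ B ∣) (h : Pair ∣ B ∣ ∣ C ∣) →
                𝓜 g → 𝓜 h → 𝓜 (g ⨾ h)
      factor  : ∀ (A B : IPoset) (g : Pair ∣ A ∣ ∣ B ∣) → IsAdjunction g →
                Σ IPoset λ C → Σ (Pair ∣ A ∣ ∣ C ∣) λ e' → Σ (Pair ∣ C ∣ ∣ B ∣) λ m →
                  𝓔 e' × 𝓜 m × ((e' ⨾ m) ≋ g)
      diagonal : ∀ (A B C D : IPoset)
                 (e' : Pair ∣ A ∣ ∣ B ∣) (m : Pair ∣ C ∣ ∣ D ∣)
                 (r : Pair ∣ A ∣ ∣ C ∣) (s : Pair ∣ B ∣ ∣ D ∣) →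
                 𝓔 e' → 𝓜 m → IsAdjunction r → IsAdjunction s →
                 (e' ⨾ s) ≋ (r ⨾ m) →
                 Σ (Pair ∣ B ∣ ∣ C ∣) λ d → IsAdjunction d ×
                   ((e' ⨾ d) ≋ r) × ((d ⨾ m) ≋ s) ×
                   (∀ (d' : Pair ∣ B ∣ ∣ C ∣) → IsAdjunction d' →
                      (e' ⨾ d') ≋ r → (d' ⨾ m) ≋ s → d' ≋ d)

  restrict : (P : IRel) {X : Obj} → X ⇒ Car P → IRel
  restrict P {X} f = record
    { Car = X
    ; Rl  = Pullback.P pb
    ; rel = Pullback.p₂ pb }
    where pb = pullback (rel P) (f ⊗₁ f)

  meet : (X : Obj) {R S : Obj} → R ⇒ X ⊗ X → S ⇒ X ⊗ X → IRel
  meet X r s = record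
    { Car = X
    ; Rl  = Pullback.P pb
    ; rel = r ∘ Pullback.p₁ pb }
    where pb = pullback r s

  module Axis (A₀ A₁ : IRel) (g : Pair A₀ A₁) where
    clo : Equalizer (id {Car A₀}) (rgt g ∘ lft g)
    clo = equalizer id (rgt g ∘ lft g)
    opn : Equalizer (id {Car A₁}) (lft g ∘ rgt g)
    opn = equalizer id (lft g ∘ rgt g)

    incl₀ : Equalizer.E clo ⇒ Car A₀
    incl₀ = Equalizer.arr clo
    incl₁ : Equalizer.E opn ⇒ Car A₁
    incl₁ = Equalizer.arr opn

    -- limit of the two opspans  clo → A₀ ← open  (inclusion, restricted ĝ)
    -- and  clo → A₁ ← open  (restricted ǧ, inclusion)
    pb : Pullback incl₀ (rgt g ∘ incl₁)
    pb = pullback incl₀ (rgt g ∘ incl₁)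
    eqz : Equalizer (lft g ∘ incl₀ ∘ Pullback.p₁ pb) (incl₁ ∘ Pullback.p₂ pb)
    eqz = equalizer (lft g ∘ incl₀ ∘ Pullback.p₁ pb) (incl₁ ∘ Pullback.p₂ pb)

    Ax : Obj
    Ax = Equalizer.E eqz

    toClo : Ax ⇒ Equalizer.E clo
    toClo = Pullback.p₁ pb ∘ Equalizer.arr eqz
    toOpn : Ax ⇒ Equalizer.E opn
    toOpn = Pullback.p₂ pb ∘ Equalizer.arr eqz

    ax₀ : Ax ⇒ Car A₀
    ax₀ = incl₀ ∘ toClo
    ax₁ : Ax ⇒ Car A₁
    ax₁ = incl₁ ∘ toOpn

    axis : IRel
    axis = meet Ax (rel (restrict A₀ ax₀)) (rel (restrict A₁ ax₁))

  PolarFactorization : Set (o ⊔ ℓ ⊔ e)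
  PolarFactorization =
    ∀ (A₀ A₁ : IPoset) (g : Pair ∣ A₀ ∣ ∣ A₁ ∣) → IsAdjunction g →
    let open Axis ∣ A₀ ∣ ∣ A₁ ∣ g in
    IsPartialOrder axis ×
    Σ (Car ∣ A₀ ∣ ⇒ Ax) λ extˡ → (ax₀ ∘ extˡ ≈ rgt g ∘ lft g) × (ax₁ ∘ extˡ ≈ lft g) ×
    Σ (Car ∣ A₁ ∣ ⇒ Ax) λ intʳ → (ax₀ ∘ intʳ ≈ rgt g) × (ax₁ ∘ intʳ ≈ lft g ∘ rgt g) ×
    Reflection {∣ A₀ ∣} {axis} ⟪ extˡ , ax₀ ⟫ ×
    Coreflection {axis} {∣ A₁ ∣} ⟪ ax₁ , intʳ ⟫ ×
    ((⟪_,_⟫ {∣ A₀ ∣} {axis} extˡ ax₀ ⨾ ⟪_,_⟫ {axis} {∣ A₁ ∣} ax₁ intʳ) ≋ g)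

Lemma2 : ∀ {o ℓ e} → Topos o ℓ e → Set (lsuc (o ⊔ ℓ ⊔ e))
Lemma2 T = IsFactorizationSystem Reflection Coreflection × PolarFactorization
  where open Internal T

-- A reflection e has ě ê = 1, so ě is split epi: in a square e ⨾ s = r ⨾ m the
-- diagonal is forced to be ⟨ř ê, ě r̂⟩.  When m is a coreflection it also equals
-- ⟨m̂ š, ŝ m̌⟩, which makes it an adjunction filling the lower triangle.  Factorizations
-- come from the axis: in a poset the triangle identities hold on the nose, so ĝǧ is
-- idempotent and a ↦ (ĝǧa, ǧa), b ↦ (ĝb, ǧĝb) are the left adjoint of the extent
-- reflection and the right adjoint of the intent coreflection; the axis is ordered as
-- a subposet of A₀, since b = ǧa on it.
module Submission where

open import Level using (Level)
open import Data.Product using (Σ; _,_; proj₁; proj₂)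
open import Relation.Binary using (IsEquivalence; Setoid)
import Relation.Binary.Reasoning.Setoid as SetoidReasoning
open import Defs

module CategoryProperties {o ℓ e : Level} (𝒞 : Category o ℓ e) where
  open Category 𝒞
  open Limits 𝒞

  hom-setoid : ∀ {A B} → Setoid ℓ e
  hom-setoid {A} {B} = record { Carrier = A ⇒ B ; _≈_ = _≈_ ; isEquivalence = equiv }

  module ≈ {A B : Obj} = IsEquivalence (equiv {A} {B})
  module HomReasoning {A B : Obj} = SetoidReasoning (hom-setoid {A} {B})

  infixr 4 _○_
  _○_ : ∀ {A B} {f g h : A ⇒ B} → f ≈ g → g ≈ h → f ≈ h
  _○_ = ≈.trans

  ∘-resp-≈ˡ : ∀ {A B C} {f h : B ⇒ C} {g : A ⇒ B} → f ≈ h → f ∘ g ≈ h ∘ g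
  ∘-resp-≈ˡ p = ∘-resp-≈ p ≈.refl

  ∘-resp-≈ʳ : ∀ {A B C} {f : B ⇒ C} {g i : A ⇒ B} → g ≈ i → f ∘ g ≈ f ∘ i
  ∘-resp-≈ʳ p = ∘-resp-≈ ≈.refl p

  sym-assoc : ∀ {A B C D} {f : A ⇒ B} {g : B ⇒ C} {h : C ⇒ D} →
              h ∘ (g ∘ f) ≈ (h ∘ g) ∘ f
  sym-assoc = ≈.sym assoc

  assoc² : ∀ {A B C D E} {f : A ⇒ B} {g : B ⇒ C} {h : C ⇒ D} {i : D ⇒ E} →
           (i ∘ (h ∘ g)) ∘ f ≈ i ∘ (h ∘ (g ∘ f))
  assoc² = assoc ○ ∘-resp-≈ʳ assoc

  assoc-middle : ∀ {A B C D E} {d : A ⇒ B} {c : B ⇒ C} {b : C ⇒ D} {a : D ⇒ E} →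
                 (a ∘ b) ∘ (c ∘ d) ≈ a ∘ ((b ∘ c) ∘ d)
  assoc-middle = assoc ○ ∘-resp-≈ʳ sym-assoc

  module _ {A B : Obj} {a : B ⇒ A} {b : A ⇒ B} (split : a ∘ b ≈ id) where
    cancelˡ : ∀ {X} {f : X ⇒ A} → a ∘ (b ∘ f) ≈ f
    cancelˡ = sym-assoc ○ ∘-resp-≈ˡ split ○ identityˡ

    cancelʳ : ∀ {Y} {f : A ⇒ Y} → (f ∘ a) ∘ b ≈ f
    cancelʳ = assoc ○ ∘-resp-≈ʳ split ○ identityʳ

    cancelInner : ∀ {X Y} {f : X ⇒ A} {h : A ⇒ Y} → (h ∘ a) ∘ (b ∘ f) ≈ h ∘ f
    cancelInner = assoc-middle ○ ∘-resp-≈ʳ (∘-resp-≈ˡ split ○ identityˡ)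

  Mono-∘ : ∀ {A B C} {m : B ⇒ C} {n : A ⇒ B} → Mono m → Mono n → Mono (m ∘ n)
  Mono-∘ mono-m mono-n f g p = mono-n f g (mono-m _ _ (sym-assoc ○ p ○ assoc))

  Equalizer-arr-mono : ∀ {A B} {f g : A ⇒ B} (eq : Equalizer f g) → Mono (Equalizer.arr eq)
  Equalizer-arr-mono {f = f} {g} eq a b p =
    unique (arr ∘ a) equalizes a ≈.refl ○ ≈.sym (unique (arr ∘ a) equalizes b (≈.sym p))
    where
      open Equalizer eq
      equalizes : f ∘ (arr ∘ a) ≈ g ∘ (arr ∘ a)
      equalizes = sym-assoc ○ ∘-resp-≈ˡ equality ○ assoc

  module _ {A B C P : Obj} {f : A ⇒ C} {g : B ⇒ C} {p₁ : P ⇒ A} {p₂ : P ⇒ B}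
           (pb : IsPullback f g p₁ p₂) where
    open IsPullback pb

    commute-∘ : ∀ {X} {h : X ⇒ P} → f ∘ (p₁ ∘ h) ≈ g ∘ (p₂ ∘ h)
    commute-∘ = sym-assoc ○ ∘-resp-≈ˡ commute ○ assoc

    IsPullback-jointly-mono : ∀ {X} {a b : X ⇒ P} →
                              p₁ ∘ a ≈ p₁ ∘ b → p₂ ∘ a ≈ p₂ ∘ b → a ≈ b
    IsPullback-jointly-mono {a = a} {b} e₁ e₂ =
      let (_ , _ , _ , unique) = universal (p₁ ∘ a) (p₂ ∘ a) commute-∘
      in unique a ≈.refl ≈.refl ○ ≈.sym (unique b (≈.sym e₁) (≈.sym e₂))

    IsPullback-mono₂ : Mono f → Mono p₂
    IsPullback-mono₂ mono-f a b p =
      IsPullback-jointly-mono (mono-f _ _ (commute-∘ ○ ∘-resp-≈ʳ p ○ ≈.sym commute-∘)) p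

    IsPullback-mono₁ : Mono g → Mono p₁
    IsPullback-mono₁ mono-g a b p =
      IsPullback-jointly-mono p (mono-g _ _ (≈.sym commute-∘ ○ ∘-resp-≈ʳ p ○ commute-∘))

module ToposProperties {o ℓ e : Level} (T : Topos o ℓ e) where
  open Topos T
  open Category cat
  open Limits cat
  open Internal T
  open CategoryProperties cat

  module _ {A B : Obj} where
    open Product (product A B)

    pair-cong : ∀ {X} {a a' : X ⇒ A} {b b' : X ⇒ B} →
                a ≈ a' → b ≈ b' → pair a b ≈ pair a' b'
    pair-cong {a = a} {b = b} p q = unique (pair a b) (project₁ ○ p) (project₂ ○ q)

    pair-∘ : ∀ {X Y} {a : X ⇒ A} {b : X ⇒ B} {k : Y ⇒ X} →
             pair a b ∘ k ≈ pair (a ∘ k) (b ∘ k)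
    pair-∘ {a = a} {b} {k} =
      unique (pair a b ∘ k) (sym-assoc ○ ∘-resp-≈ˡ project₁) (sym-assoc ○ ∘-resp-≈ˡ project₂)

  ⊗₁-∘-pair : ∀ {X A B C D} {f : A ⇒ C} {g : B ⇒ D} {a : X ⇒ A} {b : X ⇒ B} →
              (f ⊗₁ g) ∘ pair a b ≈ pair (f ∘ a) (g ∘ b)
  ⊗₁-∘-pair {A = A} {B} =
    pair-∘ ○ pair-cong (assoc ○ ∘-resp-≈ʳ project₁) (assoc ○ ∘-resp-≈ʳ project₂)
    where open Product (product A B)

  module _ (P : IRel) where
    ≤-resp-≈ : ∀ {X} {a a' b b' : X ⇒ Car P} → a ≈ a' → b ≈ b' → P ∋ a ≤ b → P ∋ a' ≤ b'
    ≤-resp-≈ p q (h , h-eq) = h , (h-eq ○ pair-cong p q)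

    ≤-∘ʳ : ∀ {X Y} {a b : X ⇒ Car P} (k : Y ⇒ X) → P ∋ a ≤ b → P ∋ (a ∘ k) ≤ (b ∘ k)
    ≤-∘ʳ k (h , h-eq) = h ∘ k , (sym-assoc ○ ∘-resp-≈ˡ h-eq ○ pair-∘)

    ≈⇒≤ : IsPartialOrder P → ∀ {X} {a b : X ⇒ Car P} → a ≈ b → P ∋ a ≤ b
    ≈⇒≤ po {a = a} p = ≤-resp-≈ ≈.refl p (IsPartialOrder.refl po a)

  Monotone-∘ : ∀ {P Q S : IRel} {f : Car P ⇒ Car Q} {g : Car Q ⇒ Car S} →
               Monotone P Q f → Monotone Q S g → Monotone P S (g ∘ f)
  Monotone-∘ {S = S} mono-f mono-g p = ≤-resp-≈ S sym-assoc sym-assoc (mono-g (mono-f p))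

  module _ (P : IRel) {Y : Obj} (f : Y ⇒ Car P) where
    private
      pb = pullback (rel P) (f ⊗₁ f)

    restrict-≤-intro : ∀ {X} {u v : X ⇒ Y} → P ∋ (f ∘ u) ≤ (f ∘ v) → restrict P f ∋ u ≤ v
    restrict-≤-intro (h , h-eq) =
      let (w , _ , w₂ , _) = IsPullback.universal (Pullback.isPullback pb) h (pair _ _)
                               (h-eq ○ ≈.sym ⊗₁-∘-pair)
      in w , w₂

    restrict-≤-elim : ∀ {X} {u v : X ⇒ Y} → restrict P f ∋ u ≤ v → P ∋ (f ∘ u) ≤ (f ∘ v)
    restrict-≤-elim (h , h-eq) =
      Pullback.p₁ pb ∘ h , (commute-∘ (Pullback.isPullback pb) ○ ∘-resp-≈ʳ h-eq ○ ⊗₁-∘-pair)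

    restrict-rel-mono : Mono (rel P) → Mono (rel (restrict P f))
    restrict-rel-mono = IsPullback-mono₂ (Pullback.isPullback pb)

  module _ (X : Obj) {R S : Obj} (r : R ⇒ X ⊗ X) (s : S ⇒ X ⊗ X) where
    private
      pb = pullback r s

    meet-≤-intro : ∀ {Y} {u v : Y ⇒ X} →
                   (Σ (Y ⇒ R) λ h → r ∘ h ≈ pair u v) → (Σ (Y ⇒ S) λ h → s ∘ h ≈ pair u v) →
                   meet X r s ∋ u ≤ v
    meet-≤-intro (h , h-eq) (h' , h'-eq) =
      let (w , w₁ , _ , _) = IsPullback.universal (Pullback.isPullback pb) h h' (h-eq ○ ≈.sym h'-eq)
      in w , (assoc ○ ∘-resp-≈ʳ w₁ ○ h-eq)

    meet-≤-elimˡ : ∀ {Y} {u v : Y ⇒ X} → meet X r s ∋ u ≤ v → Σ (Y ⇒ R) λ h → r ∘ h ≈ pair u v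
    meet-≤-elimˡ (w , w-eq) = Pullback.p₁ pb ∘ w , (sym-assoc ○ w-eq)

    meet-rel-mono : Mono r → Mono s → Mono (rel (meet X r s))
    meet-rel-mono mono-r mono-s = Mono-∘ mono-r (IsPullback-mono₁ (Pullback.isPullback pb) mono-s)

  module _ {P Q : IRel} {g : Pair P Q} (adj : IsAdjunction g) where
    open IsAdjunction adj

    lft-rgt-lft : IsPartialOrder Q → lft g ∘ (rgt g ∘ lft g) ≈ lft g
    lft-rgt-lft po-Q = IsPartialOrder.antisym po-Q
      (≤-resp-≈ Q assoc identityˡ (≤-∘ʳ Q (lft g) counit))
      (≤-resp-≈ Q identityʳ ≈.refl (lft-mono unit))

    rgt-lft-rgt : IsPartialOrder P → rgt g ∘ (lft g ∘ rgt g) ≈ rgt g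
    rgt-lft-rgt po-P = IsPartialOrder.antisym po-P
      (≤-resp-≈ P ≈.refl identityʳ (rgt-mono counit))
      (≤-resp-≈ P identityˡ assoc (≤-∘ʳ P (rgt g) unit))

  IsAdjunction-⨾ : ∀ {P Q S : IRel} → IsPartialOrder P → IsPartialOrder S →
                   {g : Pair P Q} {h : Pair Q S} →
                   IsAdjunction g → IsAdjunction h → IsAdjunction (g ⨾ h)
  IsAdjunction-⨾ {P} {Q} {S} po-P po-S {g} {h} adj-g adj-h = record
    { lft-mono = Monotone-∘ G.lft-mono H.lft-mono
    ; rgt-mono = Monotone-∘ H.rgt-mono G.rgt-mono
    ; unit     = IsPartialOrder.trans po-P G.unit
        (≤-resp-≈ P (∘-resp-≈ʳ identityˡ) (≈.sym assoc-middle) (G.rgt-mono (≤-∘ʳ Q (lft g) H.unit)))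
    ; counit   = IsPartialOrder.trans po-S
        (≤-resp-≈ S (≈.sym assoc-middle) (∘-resp-≈ʳ identityˡ) (H.lft-mono (≤-∘ʳ Q (rgt h) G.counit)))
        H.counit
    }
    where
      module G = IsAdjunction adj-g
      module H = IsAdjunction adj-h

  Reflection-⨾ : ∀ {P Q S : IRel} → IsPartialOrder P → IsPartialOrder S →
                 {g : Pair P Q} {h : Pair Q S} → Reflection g → Reflection h → Reflection (g ⨾ h)
  Reflection-⨾ po-P po-S (adj-g , split-g) (adj-h , split-h) =
    IsAdjunction-⨾ po-P po-S adj-g adj-h , (cancelInner split-g ○ split-h)

  Coreflection-⨾ : ∀ {P Q S : IRel} → IsPartialOrder P → IsPartialOrder S →
                   {g : Pair P Q} {h : Pair Q S} → Coreflection g → Coreflection h → Coreflection (g ⨾ h)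
  Coreflection-⨾ po-P po-S (adj-g , split-g) (adj-h , split-h) =
    IsAdjunction-⨾ po-P po-S adj-g adj-h , (cancelInner split-h ○ split-g)

  module _ {P Q : IRel} (po-P : IsPartialOrder P) {g : Pair P Q} (iso : IsIso g) where
    private
      adj-g = proj₁ iso
      g⁻¹ = proj₁ (proj₂ iso)
      g⨾g⁻¹≋id = proj₁ (proj₂ (proj₂ (proj₂ iso)))
      g⁻¹⨾g≋id = proj₂ (proj₂ (proj₂ (proj₂ iso)))

    rgt-≈-inverse : rgt g ≈ lft g⁻¹
    rgt-≈-inverse = IsPartialOrder.antisym po-P
      (≤-resp-≈ P (sym-assoc ○ ∘-resp-≈ˡ (proj₁ g⨾g⁻¹≋id) ○ identityˡ) identityʳ
        (IsAdjunction.lft-mono (proj₁ (proj₂ (proj₂ iso))) (IsAdjunction.counit adj-g)))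
      (≤-resp-≈ P identityˡ (assoc ○ ∘-resp-≈ʳ (proj₁ g⁻¹⨾g≋id) ○ identityʳ)
        (≤-∘ʳ P (lft g⁻¹) (IsAdjunction.unit adj-g)))

    IsIso⇒Reflection : Reflection g
    IsIso⇒Reflection = adj-g , (∘-resp-≈ʳ rgt-≈-inverse ○ proj₁ g⁻¹⨾g≋id)

    IsIso⇒Coreflection : Coreflection g
    IsIso⇒Coreflection = adj-g , (∘-resp-≈ˡ rgt-≈-inverse ○ proj₁ g⨾g⁻¹≋id)

  module Diagonal {A B C D : IRel} {e' : Pair A B} {m : Pair C D} {r : Pair A C} {s : Pair B D}
                  (ref-e : Reflection e') (coref-m : Coreflection m)
                  (adj-r : IsAdjunction r) (adj-s : IsAdjunction s)
                  (square : (e' ⨾ s) ≋ (r ⨾ m)) where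
    private
      e-split = proj₂ ref-e
      m-split = proj₂ coref-m
      square-lft = proj₁ square
      square-rgt = proj₂ square

    diagonal : Pair B C
    diagonal = ⟪ lft r ∘ rgt e' , lft e' ∘ rgt r ⟫

    lower-lft : lft m ∘ (lft r ∘ rgt e') ≈ lft s
    lower-lft = sym-assoc ○ ∘-resp-≈ˡ (≈.sym square-lft) ○ cancelʳ e-split

    lower-rgt : (lft e' ∘ rgt r) ∘ rgt m ≈ rgt s
    lower-rgt = assoc ○ ∘-resp-≈ʳ (≈.sym square-rgt) ○ cancelˡ e-split

    lft-diagonal : lft r ∘ rgt e' ≈ rgt m ∘ lft s
    lft-diagonal = ≈.sym (cancelˡ m-split) ○ ∘-resp-≈ʳ lower-lft

    rgt-diagonal : lft e' ∘ rgt r ≈ rgt s ∘ lft m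
    rgt-diagonal = ≈.sym (cancelʳ m-split) ○ ∘-resp-≈ˡ lower-rgt

    upper-lft : (lft r ∘ rgt e') ∘ lft e' ≈ lft r
    upper-lft = begin
      (lft r ∘ rgt e') ∘ lft e'   ≈⟨ ∘-resp-≈ˡ lft-diagonal ○ assoc ⟩
      rgt m ∘ (lft s ∘ lft e')    ≈⟨ ∘-resp-≈ʳ square-lft ⟩
      rgt m ∘ (lft m ∘ lft r)     ≈⟨ cancelˡ m-split ⟩
      lft r                       ∎
      where open HomReasoning

    upper-rgt : rgt e' ∘ (lft e' ∘ rgt r) ≈ rgt r
    upper-rgt = begin
      rgt e' ∘ (lft e' ∘ rgt r)   ≈⟨ ∘-resp-≈ʳ rgt-diagonal ○ sym-assoc ⟩
      (rgt e' ∘ rgt s) ∘ lft m    ≈⟨ ∘-resp-≈ˡ square-rgt ⟩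
      (rgt r ∘ rgt m) ∘ lft m     ≈⟨ cancelʳ m-split ⟩
      rgt r                       ∎
      where open HomReasoning

    diagonal-adjunction : IsAdjunction diagonal
    diagonal-adjunction = record
      { lft-mono = Monotone-∘ (IsAdjunction.rgt-mono (proj₁ ref-e)) (IsAdjunction.lft-mono adj-r)
      ; rgt-mono = Monotone-∘ (IsAdjunction.rgt-mono adj-r) (IsAdjunction.lft-mono (proj₁ ref-e))
      ; unit     = ≤-resp-≈ B (∘-resp-≈ʳ identityˡ ○ e-split) (≈.sym assoc-middle)
          (IsAdjunction.lft-mono (proj₁ ref-e) (≤-∘ʳ A (rgt e') (IsAdjunction.unit adj-r)))
      ; counit   = ≤-resp-≈ C (≈.sym assoc-middle ○ ∘-resp-≈ (≈.sym lft-diagonal) (≈.sym rgt-diagonal))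
                              (∘-resp-≈ʳ identityˡ ○ m-split)
          (IsAdjunction.rgt-mono (proj₁ coref-m) (≤-∘ʳ D (lft m) (IsAdjunction.counit adj-s)))
      }

    diagonal-unique : (d : Pair B C) → (e' ⨾ d) ≋ r → d ≋ diagonal
    diagonal-unique d (lft-eq , rgt-eq) =
      (≈.sym (cancelʳ e-split) ○ ∘-resp-≈ˡ lft-eq) , (≈.sym (cancelˡ e-split) ○ ∘-resp-≈ʳ rgt-eq)

  module Polar (A₀ A₁ : IPoset) (g : Pair ∣ A₀ ∣ ∣ A₁ ∣) (adj : IsAdjunction g) where
    open Axis ∣ A₀ ∣ ∣ A₁ ∣ g
    private
      P₀ = ∣ A₀ ∣
      P₁ = ∣ A₁ ∣
      module ≤₀ = IsPartialOrder (proj₂ A₀)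
      module ≤₁ = IsPartialOrder (proj₂ A₁)
      module Clo = Equalizer clo
      module Opn = Equalizer opn
      module Eqz = Equalizer eqz
      pb-square = Pullback.isPullback pb

    ax₀≈rgt∘ax₁ : ax₀ ≈ rgt g ∘ ax₁
    ax₀≈rgt∘ax₁ = commute-∘ pb-square ○ assoc

    ax₁≈lft∘ax₀ : ax₁ ≈ lft g ∘ ax₀
    ax₁≈lft∘ax₀ = sym-assoc ○ ≈.sym Eqz.equality ○ assoc ○ ∘-resp-≈ʳ assoc

    ax₁-∘ : ∀ {X} (u : X ⇒ Ax) → ax₁ ∘ u ≈ lft g ∘ (ax₀ ∘ u)
    ax₁-∘ u = ∘-resp-≈ˡ ax₁≈lft∘ax₀ ○ assoc

    ax₀-mono : Mono ax₀
    ax₀-mono a b ax₀-eq = Equalizer-arr-mono eqz a b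
      (IsPullback-jointly-mono pb-square
        (Equalizer-arr-mono clo _ _ (≈.sym assoc² ○ ax₀-eq ○ assoc²))
        (Equalizer-arr-mono opn _ _ (≈.sym assoc² ○ ax₁-eq ○ assoc²)))
      where
        ax₁-eq : ax₁ ∘ a ≈ ax₁ ∘ b
        ax₁-eq = ax₁-∘ a ○ ∘-resp-≈ʳ ax₀-eq ○ ≈.sym (ax₁-∘ b)

    module ClosedLift {X : Obj} (a : X ⇒ Car P₀) (closed : (rgt g ∘ lft g) ∘ a ≈ a) where
      private
        clo-eq : id ∘ a ≈ (rgt g ∘ lft g) ∘ a
        clo-eq = identityˡ ○ ≈.sym closed
        opn-eq : id ∘ (lft g ∘ a) ≈ (lft g ∘ rgt g) ∘ (lft g ∘ a)
        opn-eq = identityˡ ○ ≈.sym (assoc ○ ∘-resp-≈ʳ (sym-assoc ○ closed))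
        to-clo = Clo.equalize a clo-eq
        to-opn = Opn.equalize (lft g ∘ a) opn-eq
        opspan-eq : incl₀ ∘ to-clo ≈ (rgt g ∘ incl₁) ∘ to-opn
        opspan-eq = Clo.universal a clo-eq
                  ○ ≈.sym (assoc ○ ∘-resp-≈ʳ (Opn.universal (lft g ∘ a) opn-eq) ○ sym-assoc ○ closed)
        to-pb = IsPullback.universal pb-square to-clo to-opn opspan-eq
        to-pb₁ = proj₁ (proj₂ to-pb)
        to-pb₂ = proj₁ (proj₂ (proj₂ to-pb))
        eqz-eq : (lft g ∘ (incl₀ ∘ Pullback.p₁ pb)) ∘ proj₁ to-pb ≈ (incl₁ ∘ Pullback.p₂ pb) ∘ proj₁ to-pb
        eqz-eq = assoc² ○ ∘-resp-≈ʳ (∘-resp-≈ʳ to-pb₁ ○ Clo.universal a clo-eq)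
               ○ ≈.sym (assoc ○ ∘-resp-≈ʳ to-pb₂ ○ Opn.universal (lft g ∘ a) opn-eq)

      lift : X ⇒ Ax
      lift = Eqz.equalize (proj₁ to-pb) eqz-eq

      ax₀-lift : ax₀ ∘ lift ≈ a
      ax₀-lift = assoc² ○ ∘-resp-≈ʳ (∘-resp-≈ʳ (Eqz.universal (proj₁ to-pb) eqz-eq) ○ to-pb₁)
               ○ Clo.universal a clo-eq

    open ClosedLift using (lift; ax₀-lift)

    rgt∘lft-closed : (rgt g ∘ lft g) ∘ (rgt g ∘ lft g) ≈ rgt g ∘ lft g
    rgt∘lft-closed = assoc ○ ∘-resp-≈ʳ (lft-rgt-lft adj (proj₂ A₁))

    rgt-closed : (rgt g ∘ lft g) ∘ rgt g ≈ rgt g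
    rgt-closed = assoc ○ rgt-lft-rgt adj (proj₂ A₀)

    extˡ : Car P₀ ⇒ Ax
    extˡ = lift (rgt g ∘ lft g) rgt∘lft-closed

    ax₀-extˡ : ax₀ ∘ extˡ ≈ rgt g ∘ lft g
    ax₀-extˡ = ax₀-lift (rgt g ∘ lft g) rgt∘lft-closed

    ax₁-extˡ : ax₁ ∘ extˡ ≈ lft g
    ax₁-extˡ = ax₁-∘ extˡ ○ ∘-resp-≈ʳ ax₀-extˡ ○ lft-rgt-lft adj (proj₂ A₁)

    intʳ : Car P₁ ⇒ Ax
    intʳ = lift (rgt g) rgt-closed

    ax₀-intʳ : ax₀ ∘ intʳ ≈ rgt g
    ax₀-intʳ = ax₀-lift (rgt g) rgt-closed

    ax₁-intʳ : ax₁ ∘ intʳ ≈ lft g ∘ rgt g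
    ax₁-intʳ = ax₁-∘ intʳ ○ ∘-resp-≈ʳ ax₀-intʳ

    axis-≤-intro : ∀ {X} {u v : X ⇒ Ax} → P₀ ∋ (ax₀ ∘ u) ≤ (ax₀ ∘ v) → axis ∋ u ≤ v
    axis-≤-intro {u = u} {v} p = meet-≤-intro Ax _ _ (restrict-≤-intro P₀ ax₀ p)
      (restrict-≤-intro P₁ ax₁
        (≤-resp-≈ P₁ (≈.sym (ax₁-∘ u)) (≈.sym (ax₁-∘ v)) (IsAdjunction.lft-mono adj p)))

    axis-≤-elim₀ : ∀ {X} {u v : X ⇒ Ax} → axis ∋ u ≤ v → P₀ ∋ (ax₀ ∘ u) ≤ (ax₀ ∘ v)
    axis-≤-elim₀ p = restrict-≤-elim P₀ ax₀ (meet-≤-elimˡ Ax _ _ p)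

    axis-≤-elim₁ : ∀ {X} {u v : X ⇒ Ax} → axis ∋ u ≤ v → P₁ ∋ (ax₁ ∘ u) ≤ (ax₁ ∘ v)
    axis-≤-elim₁ {u = u} {v} p =
      ≤-resp-≈ P₁ (≈.sym (ax₁-∘ u)) (≈.sym (ax₁-∘ v)) (IsAdjunction.lft-mono adj (axis-≤-elim₀ p))

    axis-isPartialOrder : IsPartialOrder axis
    axis-isPartialOrder = record
      { rel-mono = meet-rel-mono Ax _ _ (restrict-rel-mono P₀ ax₀ ≤₀.rel-mono)
                                         (restrict-rel-mono P₁ ax₁ ≤₁.rel-mono)
      ; refl     = λ a → axis-≤-intro (≤₀.refl (ax₀ ∘ a))
      ; trans    = λ p q → axis-≤-intro (≤₀.trans (axis-≤-elim₀ p) (axis-≤-elim₀ q))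
      ; antisym  = λ p q → ax₀-mono _ _ (≤₀.antisym (axis-≤-elim₀ p) (axis-≤-elim₀ q))
      }

    extˡ∘ax₀≈id : extˡ ∘ ax₀ ≈ id
    extˡ∘ax₀≈id = ax₀-mono _ _ (begin
      ax₀ ∘ (extˡ ∘ ax₀)            ≈⟨ sym-assoc ○ ∘-resp-≈ˡ ax₀-extˡ ○ assoc ⟩
      rgt g ∘ (lft g ∘ ax₀)         ≈⟨ ∘-resp-≈ʳ ax₁≈lft∘ax₀ ⟨
      rgt g ∘ ax₁                   ≈⟨ ax₀≈rgt∘ax₁ ⟨
      ax₀                           ≈⟨ identityʳ ⟨
      ax₀ ∘ id                      ∎)
      where open HomReasoning

    intʳ∘ax₁≈id : intʳ ∘ ax₁ ≈ id
    intʳ∘ax₁≈id = ax₀-mono _ _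
      (sym-assoc ○ ∘-resp-≈ˡ ax₀-intʳ ○ ≈.sym ax₀≈rgt∘ax₁ ○ ≈.sym identityʳ)

    extent-reflection : Reflection {P₀} {axis} ⟪ extˡ , ax₀ ⟫
    extent-reflection = record
      { lft-mono = λ p → axis-≤-intro
          (≤-resp-≈ P₀ ax₀-extˡ-∘ ax₀-extˡ-∘ (IsAdjunction.rgt-mono adj (IsAdjunction.lft-mono adj p)))
      ; rgt-mono = axis-≤-elim₀
      ; unit     = ≤-resp-≈ P₀ ≈.refl (≈.sym ax₀-extˡ) (IsAdjunction.unit adj)
      ; counit   = ≈⇒≤ axis axis-isPartialOrder extˡ∘ax₀≈id
      } , extˡ∘ax₀≈id
      where
        ax₀-extˡ-∘ : ∀ {X} {a : X ⇒ Car P₀} → rgt g ∘ (lft g ∘ a) ≈ ax₀ ∘ (extˡ ∘ a)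
        ax₀-extˡ-∘ = sym-assoc ○ ∘-resp-≈ˡ (≈.sym ax₀-extˡ) ○ assoc

    intent-coreflection : Coreflection {axis} {P₁} ⟪ ax₁ , intʳ ⟫
    intent-coreflection = record
      { lft-mono = axis-≤-elim₁
      ; rgt-mono = λ p → axis-≤-intro
          (≤-resp-≈ P₀ ax₀-intʳ-∘ ax₀-intʳ-∘ (IsAdjunction.rgt-mono adj p))
      ; unit     = ≈⇒≤ axis axis-isPartialOrder (≈.sym intʳ∘ax₁≈id)
      ; counit   = ≤-resp-≈ P₁ (≈.sym ax₁-intʳ) ≈.refl (IsAdjunction.counit adj)
      } , intʳ∘ax₁≈id
      where
        ax₀-intʳ-∘ : ∀ {X} {b : X ⇒ Car P₁} → rgt g ∘ b ≈ ax₀ ∘ (intʳ ∘ b)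
        ax₀-intʳ-∘ = ∘-resp-≈ˡ (≈.sym ax₀-intʳ) ○ assoc

  polar-factorization : PolarFactorization
  polar-factorization A₀ A₁ g adj =
    axis-isPartialOrder , extˡ , ax₀-extˡ , ax₁-extˡ , intʳ , ax₀-intʳ , ax₁-intʳ ,
    extent-reflection , intent-coreflection , (ax₁-extˡ , ax₀-intʳ)
    where open Polar A₀ A₁ g adj

  reflection-coreflection-factorization : IsFactorizationSystem Reflection Coreflection
  reflection-coreflection-factorization = record
    { iso⊆𝓔    = λ A _ _ → IsIso⇒Reflection (proj₂ A)
    ; iso⊆𝓜    = λ A _ _ → IsIso⇒Coreflection (proj₂ A)
    ; 𝓔-comp   = λ A _ C _ _ → Reflection-⨾ (proj₂ A) (proj₂ C)
    ; 𝓜-comp   = λ A _ C _ _ → Coreflection-⨾ (proj₂ A) (proj₂ C)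
    ; factor   = λ A₀ A₁ g adj → let open Polar A₀ A₁ g adj in
        (_ , axis-isPartialOrder) , _ , _ , extent-reflection , intent-coreflection ,
        (ax₁-extˡ , ax₀-intʳ)
    ; diagonal = λ _ _ _ _ _ _ _ _ ref-e coref-m adj-r adj-s square →
        let open Diagonal ref-e coref-m adj-r adj-s square in
        diagonal , diagonal-adjunction , (upper-lft , upper-rgt) , (lower-lft , lower-rgt) ,
        λ d _ upper _ → diagonal-unique d upper
    }

lemma2 : ∀ {o ℓ e : Level} (T : Topos o ℓ e) → Lemma2 T
lemma2 T = reflection-coreflection-factorization , polar-factorization
  where open ToposProperties T
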